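{- Let $F_1,F_2$ be frequency arrays of order $k$. If $O_1$ and $O_2$ are outline arrays corresponding to $F_1$ and $F_2$ respectively, then there exists an outline array corresponding to the frequency array $F^*$ of order $k$ with $F^*(i,j)=F_1(i,j)+F_2(i,j)$ for all $i,j\in[k]$.
   Context: A frequency array $F$ of order $k$ is a $k\times k$ array each of whose cells contains a single non-negative integer. Given a $k\times k$ array $O$ of multisets with elements from $[k]$, let $O(i,j)$ be the multiset in cell $(i,j)$, $O^i_\ell$ the number of copies of symbol $\ell$ in row $i$, and ${}^jO_\ell$ the number of copies of symbol $\ell$ in column $j$ (counted with multiplicity). $O$ is an outline array corresponding to $F$ if for all $i,j,\ell\in[k]$: $|O(i,j)|=F(i,j)$, $O^i_\ell=F(i,\ell)$, and ${}^jO_\ell=F(\ell,j)$. -}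

module Defs where

open import Data.Nat using (ℕ; _+_)
open import Data.Fin using (Fin)
open import Data.Vec.Functional using (Vector)
open import Data.Vec.Functional using () renaming (foldr to vfoldr)
open import Relation.Binary.PropositionalEquality using (_≡_)

Σ[_] : ∀ k → (Fin k → ℕ) → ℕ
Σ[ k ] f = vfoldr _+_ 0 f

FrequencyArray : ℕ → Set
FrequencyArray k = Fin k → Fin k → ℕ

-- A finite multiset with elements from [k], given by its multiplicity function.
Multiset : ℕ → Set
Multiset k = Fin k → ℕ

∣_∣ₘ : ∀ {k} → Multiset k → ℕ
∣_∣ₘ {k} m = Σ[ k ] m

MultisetArray : ℕ → Set
MultisetArray k = Fin k → Fin k → Multiset k

rowCount : ∀ {k} → MultisetArray k → Fin k → Fin k → ℕ
rowCount {k} O i ℓ = Σ[ k ] (λ j → O i j ℓ)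

colCount : ∀ {k} → MultisetArray k → Fin k → Fin k → ℕ
colCount {k} O j ℓ = Σ[ k ] (λ i → O i j ℓ)

record IsOutlineArray {k : ℕ} (F : FrequencyArray k) (O : MultisetArray k) : Set where
  field
    cellSize : ∀ i j → ∣ O i j ∣ₘ ≡ F i j
    rowSym   : ∀ i ℓ → rowCount O i ℓ ≡ F i ℓ
    colSym   : ∀ j ℓ → colCount O j ℓ ≡ F ℓ j

_⊕_ : ∀ {k} → FrequencyArray k → FrequencyArray k → FrequencyArray k
(F₁ ⊕ F₂) i j = F₁ i j + F₂ i j

{-# OPTIONS --safe #-}

-- Take the cellwise multiset sum of O₁ and O₂: cell sizes, row counts and column
-- counts are all sums of multiplicities, hence additive in the array.

module Submission where

open import Defs
open import Data.Nat using (ℕ; _+_)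
open import Data.Nat.Properties using (+-0-commutativeMonoid)
open import Algebra.Properties.CommutativeMonoid.Sum +-0-commutativeMonoid using (∑-distrib-+)
open import Data.Fin using (Fin)
open import Data.Product using (∃; _,_)
open import Relation.Binary.PropositionalEquality using (_≡_; trans; cong₂)

_⊞_ : ∀ {k} → MultisetArray k → MultisetArray k → MultisetArray k
(O₁ ⊞ O₂) i j ℓ = O₁ i j ℓ + O₂ i j ℓ

Σ-+-≡ : ∀ {k} (f g : Fin k → ℕ) {a b : ℕ} →
        Σ[ k ] f ≡ a → Σ[ k ] g ≡ b → Σ[ k ] (λ x → f x + g x) ≡ a + b
Σ-+-≡ f g Σf≡a Σg≡b = trans (∑-distrib-+ f g) (cong₂ _+_ Σf≡a Σg≡b)

⊞-isOutlineArray : ∀ {k} {F₁ F₂ : FrequencyArray k} {O₁ O₂ : MultisetArray k} →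
                   IsOutlineArray F₁ O₁ → IsOutlineArray F₂ O₂ →
                   IsOutlineArray (F₁ ⊕ F₂) (O₁ ⊞ O₂)
⊞-isOutlineArray {O₁ = O₁} {O₂} h₁ h₂ = record
  { cellSize = λ i j → Σ-+-≡ (O₁ i j) (O₂ i j) (cellSize h₁ i j) (cellSize h₂ i j)
  ; rowSym   = λ i ℓ → Σ-+-≡ (λ j → O₁ i j ℓ) (λ j → O₂ i j ℓ) (rowSym h₁ i ℓ) (rowSym h₂ i ℓ)
  ; colSym   = λ j ℓ → Σ-+-≡ (λ i → O₁ i j ℓ) (λ i → O₂ i j ℓ) (colSym h₁ j ℓ) (colSym h₂ j ℓ)
  }
  where open IsOutlineArray

mainTheorem18 : (k : ℕ) (F₁ F₂ : FrequencyArray k) (O₁ O₂ : MultisetArray k)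
    → IsOutlineArray F₁ O₁ → IsOutlineArray F₂ O₂
    → ∃ λ (O : MultisetArray k) → IsOutlineArray (F₁ ⊕ F₂) O
mainTheorem18 k F₁ F₂ O₁ O₂ h₁ h₂ = O₁ ⊞ O₂ , ⊞-isOutlineArray h₁ h₂
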